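{- Let $e\ge2$ and $w\in\tilde{\mathfrak S}_e$. Define subsets $A_0,\dots,A_{e-1}$ of $\mathbb Z$ by $A_0=w(\mathbb Z_{\le 0})$ and, for $c\in\{1,\dots,e-1\}$, $A_c=A_{c-1}\cup\{w(c)\}$ (where $w(c)\notin A_{c-1}$). Then for every $c\in\{0,\dots,e-1\}$, $A_c$ is the abacus of the $c$-charged $e$-core $w\cdot\emptyset_c$.
   Context: The affine symmetric group $\tilde{\mathfrak S}_e$ is the group of bijections $w:\mathbb Z\to\mathbb Z$ with $w(i+e)=w(i)+e$ for all $i$ and $w(1)+\dots+w(e)=e(e+1)/2$ (generated by $s_0,\dots,s_{e-1}$, $s_i$ swapping $i+ke$ and $i+1+ke$ for all $k$). The abacus of a $c$-charged partition $\lambda=(\lambda_1\ge\dots\ge\lambda_h>0)$ is $\{\lambda_k-k+c+1:k\ge1\}$ ($\lambda_k=0$ for $k>h$); every subset of $\mathbb Z$ containing all sufficiently negative and no sufficiently large integers is the abacus of a unique charged partition. $\emptyset_c$ is the empty $c$-charged partition (abacus $\mathbb Z_{\le c}$). $w\cdot\lambda$ is the charged partition with abacus $w(A)$, $A$ the abacus of $\lambda$. An $e$-core is a charged partition whose abacus $A$ satisfies $x\in A\Rightarrow x-e\in A$. -}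

module Defs where

open import Data.Nat as ℕ using (ℕ; zero; suc)
open import Data.Integer using (ℤ; +_; _+_; _-_; _*_; _≤_)
open import Data.List using (List; []; _∷_)
open import Data.List.Relation.Unary.All using (All)
open import Data.List.Relation.Unary.Linked using (Linked)
open import Data.Product using (Σ; ∃; ∃-syntax; _×_; _,_)
open import Data.Sum using (_⊎_)
open import Function.Definitions using (Injective; Surjective)
open import Relation.Binary.PropositionalEquality using (_≡_)

sumTo : ℕ → (ℤ → ℤ) → ℤ
sumTo zero    f = + 0
sumTo (suc n) f = sumTo n f + f (+ suc n)

-- Elements w of the affine symmetric group S~_e: bijections ℤ → ℤ with
-- w(i+e) = w(i)+e and w(1)+...+w(e) = e(e+1)/2 (written as 2·Σ = e(e+1)).
record AffPerm (e : ℕ) : Set where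
  field
    fn          : ℤ → ℤ
    injective   : Injective _≡_ _≡_ fn
    surjective  : Surjective _≡_ _≡_ fn
    periodic    : ∀ i → fn (i + + e) ≡ fn i + + e
    sumCond     : + 2 * sumTo e fn ≡ + e * + (suc e)
open AffPerm public

record ChargedPartition : Set where
  constructor mkCP
  field
    charge     : ℤ
    parts      : List ℕ
    decreasing : Linked ℕ._≥_ parts
    positive   : All (ℕ._<_ 0) parts
open ChargedPartition public

-- nth λ k = λ_{k+1}, with λ_j = 0 for j > h
nth : List ℕ → ℕ → ℕ
nth []       k       = 0
nth (x ∷ xs) zero    = x
nth (x ∷ xs) (suc k) = nth xs k

-- Abacus of a c-charged partition: { λ_k - k + c + 1 : k ≥ 1 }
-- (indexing with k = j+1, j ≥ 0: λ_{j+1} - j + c).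
Abacus : ChargedPartition → ℤ → Set
Abacus μ x = ∃[ j ] x ≡ + nth (parts μ) j - + j + charge μ

emptyCP : ℤ → ChargedPartition
emptyCP c = mkCP c [] Linked.[] All.[]

IsAction : ∀ {e} → AffPerm e → ChargedPartition → ChargedPartition → Set
IsAction w μ ν = ∀ x → (Abacus ν x → ∃[ y ] Abacus μ y × fn w y ≡ x)
                     × ((∃[ y ] Abacus μ y × fn w y ≡ x) → Abacus ν x)

IsCore : ℕ → ChargedPartition → Set
IsCore e μ = ∀ x → Abacus μ x → Abacus μ (x - + e)

Aset : ∀ {e} → AffPerm e → ℕ → ℤ → Set
Aset w zero    x = ∃[ y ] y ≤ + 0 × fn w y ≡ x
Aset w (suc c) x = Aset w c x ⊎ x ≡ fn w (+ suc c)

module Submission where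

-- A_c is the image w(ℤ≤c), closed under x ↦ x − e by periodicity, so the point is that it is
-- the abacus of a partition of charge exactly c. Since w moves every integer by less than some M,
-- w(ℤ≤c) contains ℤ≤(c − M) and lies in ℤ≤(c + M); it is then the abacus of a c-charged partition
-- iff the window (c − M, c + M] holds exactly M of its beads. Sliding c to c + 1 loses one bead at
-- the bottom and gains w(c + 1), so this count is independent of c. The first moment of the beads
-- in the window changes by M − count + (w(c + 1) − (c + 1)) and is e-periodic in c, so summing over
-- a period and using Σ (w(i) − i) = 0 forces the count to be M.

open import Defs
open import Data.Nat as ℕ using (ℕ; zero; suc)
import Data.Nat.Properties as ℕP
open import Data.Integer as ℤ
  using (ℤ; +_; -[1+_]; _+_; _-_; -_; _*_; _≤_; _<_; ∣_∣; +≤+; -≤+; +<+; pred; _≤?_; _<?_; _≟_)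
  renaming (suc to sucℤ)
open import Data.Integer.Properties
open import Data.Integer.Tactic.RingSolver using (solve-∀)
open import Data.Integer.DivMod using (_%ℕ_; _/ℕ_; a≡a%ℕn+[a/ℕn]*n; n%ℕd<d)
open import Data.List using (List; []; _∷_)
open import Data.List.Relation.Unary.All using (All; []; _∷_)
open import Data.List.Relation.Unary.Linked using (Linked; []; [-]; _∷_)
open import Data.Product using (∃-syntax; _×_; _,_; proj₁; proj₂)
open import Data.Sum using (_⊎_; inj₁; inj₂)
open import Data.Empty using (⊥-elim)
open import Function using (_∘_)
open import Level using (0ℓ)
open import Relation.Nullary using (¬_; Dec; yes; no)
open import Relation.Nullary.Decidable using (_×-dec_)
open import Relation.Unary using (Pred; Decidable; _⊆_; _≐_; _∪_; ｛_｝)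
open import Relation.Unary.Properties using (≐-trans; ≐-sym)
open import Relation.Binary.PropositionalEquality

≤-by-gap : ∀ {x y} k → y - x ≡ + k → x ≤ y
≤-by-gap k eq = 0≤i-j⇒j≤i (subst (+ 0 ≤_) (sym eq) (+≤+ ℕ.z≤n))

≤-by-gap₁ : ∀ {p q x y} k → y - x ≡ (q - p) + + k → p ≤ q → x ≤ y
≤-by-gap₁ {p} {q} k eq p≤q = 0≤i-j⇒j≤i (subst (+ 0 ≤_) (sym eq)
  (+-mono-≤ {+ 0} {q - p} {+ 0} {+ k} (i≤j⇒0≤j-i p≤q) (+≤+ ℕ.z≤n)))

+-cancelʳ : ∀ {i j} k → i + k ≡ j + k → i ≡ j
+-cancelʳ {i} {j} k i+k≡j+k = trans (eq i k) (trans (cong (_- k) i+k≡j+k) (sym (eq j k)))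
  where eq : ∀ i k → i ≡ i + k - k
        eq = solve-∀

windowSum : (ℤ → ℤ) → ℤ → ℕ → ℤ
windowSum h a zero    = + 0
windowSum h a (suc n) = h (sucℤ a) + windowSum h (sucℤ a) n

suc-+-swap : ∀ a n → sucℤ a + + n ≡ a + + suc n
suc-+-swap a n = eq a (+ n)
  where eq : ∀ a n → + 1 + a + n ≡ a + (+ 1 + n)
        eq = solve-∀

windowSum-snoc : ∀ h a n → windowSum h a (suc n) ≡ windowSum h a n + h (a + + suc n)
windowSum-snoc h a zero = trans (+-identityʳ _) (trans (cong h (+-comm (+ 1) a)) (sym (+-identityˡ _)))
windowSum-snoc h a (suc n) = begin
  h (sucℤ a) + windowSum h (sucℤ a) (suc n)                       ≡⟨ cong (λ t → h (sucℤ a) + t) (windowSum-snoc h (sucℤ a) n) ⟩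
  h (sucℤ a) + (windowSum h (sucℤ a) n + h (sucℤ a + + suc n))    ≡⟨ sym (+-assoc (h (sucℤ a)) _ _) ⟩
  h (sucℤ a) + windowSum h (sucℤ a) n + h (sucℤ a + + suc n)      ≡⟨ cong (λ x → h (sucℤ a) + windowSum h (sucℤ a) n + h x) (suc-+-swap a (suc n)) ⟩
  h (sucℤ a) + windowSum h (sucℤ a) n + h (a + + suc (suc n))     ∎
  where open ≡-Reasoning

i<suc[i] : ∀ i → i < sucℤ i
i<suc[i] i = suc[i]≤j⇒i<j ≤-refl

suc≤+suc : ∀ a n → sucℤ a ≤ a + + suc n
suc≤+suc a n = ≤-by-gap n (eq a (+ n))
  where eq : ∀ a n → a + (+ 1 + n) - (+ 1 + a) ≡ n
        eq = solve-∀

windowSum-cong : ∀ {h h′} a n → (∀ {x} → a < x → x ≤ a + + n → h x ≡ h′ x) →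
                 windowSum h a n ≡ windowSum h′ a n
windowSum-cong a zero    h≡h′ = refl
windowSum-cong a (suc n) h≡h′ = cong₂ _+_ (h≡h′ (i<suc[i] a) (suc≤+suc a n))
  (windowSum-cong (sucℤ a) n λ {x} a<x x≤ →
    h≡h′ (<-trans (i<suc[i] a) a<x) (subst (x ≤_) (suc-+-swap a n) x≤))

windowSum-+ : ∀ h h′ a n → windowSum (λ x → h x + h′ x) a n ≡ windowSum h a n + windowSum h′ a n
windowSum-+ h h′ a zero    = refl
windowSum-+ h h′ a (suc n) = trans (cong (λ t → h (sucℤ a) + h′ (sucℤ a) + t) (windowSum-+ h h′ (sucℤ a) n))
  (+-interchange (h (sucℤ a)) (h′ (sucℤ a)) _ _)
  where +-interchange : ∀ x y u v → x + y + (u + v) ≡ x + u + (y + v)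
        +-interchange = solve-∀

windowSum-neg : ∀ h a n → windowSum (λ x → - h x) a n ≡ - windowSum h a n
windowSum-neg h a zero    = refl
windowSum-neg h a (suc n) = trans (cong (λ t → - h (sucℤ a) + t) (windowSum-neg h (sucℤ a) n))
  (sym (neg-distrib-+ (h (sucℤ a)) _))

windowSum-const : ∀ k a n → windowSum (λ _ → k) a n ≡ + n * k
windowSum-const k a zero    = sym (*-zeroˡ k)
windowSum-const k a (suc n) = trans (cong (λ t → k + t) (windowSum-const k (sucℤ a) n)) (eq k (+ n))
  where eq : ∀ k n → k + n * k ≡ (+ 1 + n) * k
        eq = solve-∀

windowSum-vanishing : ∀ {h} a n → (∀ {x} → a < x → h x ≡ + 0) → windowSum h a n ≡ + 0
windowSum-vanishing a n h≡0 =
  trans (windowSum-cong a n λ a<x _ → h≡0 a<x) (trans (windowSum-const (+ 0) a n) (*-zeroʳ (+ n)))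

windowSum-point : ∀ {h} a n z → a < z → z ≤ a + + n → (∀ {x} → x ≢ z → h x ≡ + 0) →
                  windowSum h a n ≡ h z
windowSum-point a zero z a<z z≤a _ = ⊥-elim (<⇒≱ a<z (subst (z ≤_) (+-identityʳ a) z≤a))
windowSum-point {h} a (suc n) z a<z z≤ h≡0 with sucℤ a ≟ z
... | yes refl = trans (cong (λ t → h (sucℤ a) + t) (windowSum-vanishing (sucℤ a) n λ a<x → h≡0 (<⇒≢ a<x ∘ sym)))
                       (+-identityʳ _)
... | no a+1≢z = trans (cong (λ t → t + windowSum h (sucℤ a) n) (h≡0 a+1≢z))
  (trans (+-identityˡ _) (windowSum-point (sucℤ a) n z (≤∧≢⇒< (i<j⇒suc[i]≤j a<z) a+1≢z)
    (subst (z ≤_) (sym (suc-+-swap a n)) z≤) h≡0))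

windowSum-shift : ∀ h a d n → windowSum h (a + d) n ≡ windowSum (λ x → h (x + d)) a n
windowSum-shift h a d zero    = refl
windowSum-shift h a d (suc n) = cong₂ _+_ (cong h (sym (+-assoc (+ 1) a d)))
  (trans (cong (λ b → windowSum h b n) (sym (+-assoc (+ 1) a d))) (windowSum-shift h (sucℤ a) d n))

windowSum-telescope : ∀ G a n → windowSum (λ x → G x - G (pred x)) a n ≡ G (a + + n) - G a
windowSum-telescope G a zero    = sym (i≡j⇒i-j≡0 (cong G (+-identityʳ a)))
windowSum-telescope G a (suc n) = begin
  G (sucℤ a) - G (pred (sucℤ a)) + windowSum (λ x → G x - G (pred x)) (sucℤ a) n
    ≡⟨ cong₂ (λ u v → G (sucℤ a) - G u + v) (pred-suc a) (windowSum-telescope G (sucℤ a) n) ⟩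
  G (sucℤ a) - G a + (G (sucℤ a + + n) - G (sucℤ a))
    ≡⟨ cancel (G (sucℤ a)) (G a) (G (sucℤ a + + n)) ⟩
  G (sucℤ a + + n) - G a
    ≡⟨ cong (λ b → G b - G a) (suc-+-swap a n) ⟩
  G (a + + suc n) - G a ∎
  where
  open ≡-Reasoning
  cancel : ∀ u v w → u - v + (w - u) ≡ w - v
  cancel = solve-∀

sumTo≡windowSum : ∀ n f → sumTo n f ≡ windowSum f (+ 0) n
sumTo≡windowSum zero    f = refl
sumTo≡windowSum (suc n) f = trans (cong (_+ f (+ suc n)) (sumTo≡windowSum n f)) (sym (windowSum-snoc f (+ 0) n))

gauss : ∀ n → + 2 * windowSum (λ x → x) (+ 0) n ≡ + n * + suc n
gauss zero    = refl
gauss (suc n) = begin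
  + 2 * windowSum (λ x → x) (+ 0) (suc n)          ≡⟨ cong (+ 2 *_) (windowSum-snoc (λ x → x) (+ 0) n) ⟩
  + 2 * (windowSum (λ x → x) (+ 0) n + + suc n)    ≡⟨ *-distribˡ-+ (+ 2) (windowSum (λ x → x) (+ 0) n) (+ suc n) ⟩
  + 2 * windowSum (λ x → x) (+ 0) n + + 2 * + suc n ≡⟨ cong (_+ + 2 * + suc n) (gauss n) ⟩
  + n * + suc n + + 2 * + suc n                     ≡⟨ eq (+ n) ⟩
  + suc n * + suc (suc n)                           ∎
  where
  open ≡-Reasoning
  eq : ∀ n → n * (+ 1 + n) + + 2 * (+ 1 + n) ≡ (+ 1 + n) * (+ 1 + (+ 1 + n))
  eq = solve-∀

AbacusOf : List ℕ → ℤ → Pred ℤ 0ℓ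
AbacusOf ps c x = ∃[ j ] x ≡ + nth ps j - + j + c

abacus-[] : ∀ c → AbacusOf [] c ≐ (_≤ c)
abacus-[] c = (λ { (j , refl) → ≤-by-gap j (eq (+ j) c) })
            , λ {x} x≤c → ∣ c - x ∣ , trans (eq′ x c) (cong (λ t → + 0 - t + c) (sym (0≤i⇒+∣i∣≡i (i≤j⇒0≤j-i x≤c))))
  where
  eq : ∀ j c → c - (+ 0 - j + c) ≡ j
  eq = solve-∀
  eq′ : ∀ x c → x ≡ + 0 - (c - x) + c
  eq′ = solve-∀

abacus-∷ : ∀ k ps c → AbacusOf (k ∷ ps) (sucℤ c) ≐ (AbacusOf ps c ∪ ｛ + k + sucℤ c ｝)
abacus-∷ k ps c = (λ { (zero , refl) → inj₂ (sym (head (+ k) c))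
                     ; (suc j , refl) → inj₁ (j , tail (+ nth ps j) (+ j) c) })
                , λ { (inj₁ (j , refl)) → suc j , sym (tail (+ nth ps j) (+ j) c)
                    ; (inj₂ refl) → zero , sym (head (+ k) c) }
  where
  head : ∀ k c → k - + 0 + (+ 1 + c) ≡ k + (+ 1 + c)
  head = solve-∀
  tail : ∀ x j c → x - (+ 1 + j) + (+ 1 + c) ≡ x - j + c
  tail = solve-∀

topBead : ∀ ps c → AbacusOf ps c (+ nth ps 0 + c)
topBead ps c = 0 , cong (_+ c) (sym (+-identityʳ (+ nth ps 0)))

≤suc≐≤∪suc : ∀ c → (_≤ sucℤ c) ≐ (AbacusOf [] c ∪ ｛ sucℤ c ｝)
≤suc≐≤∪suc c = split , λ { (inj₁ x∈) → ≤-trans (proj₁ (abacus-[] c) x∈) (i≤suc[i] c) ; (inj₂ refl) → ≤-refl }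
  where
  split : (_≤ sucℤ c) ⊆ (AbacusOf [] c ∪ ｛ sucℤ c ｝)
  split {x} x≤ with x ≟ sucℤ c
  ... | yes refl = inj₂ refl
  ... | no x≢ = inj₁ (proj₂ (abacus-[] c) (subst (x ≤_) (pred-suc c) (i<j⇒i≤pred[j] (≤∧≢⇒< x≤ x≢))))

+∣gap∣ : ∀ c {U} → sucℤ c ≤ U → + ∣ U - sucℤ c ∣ ≡ U - sucℤ c
+∣gap∣ c le = 0≤i⇒+∣i∣≡i (i≤j⇒0≤j-i le)

prependBead : ∀ c U ps → sucℤ c < U → Linked ℕ._≥_ (∣ U - sucℤ c ∣ ∷ ps) → All (0 ℕ.<_) ps →
              ∃[ ν ] charge ν ≡ sucℤ c × Abacus ν ≐ (AbacusOf ps c ∪ ｛ U ｝)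
prependBead c U ps c<U lk pos =
  mkCP (sucℤ c) (∣ U - sucℤ c ∣ ∷ ps) lk (gap>0 ∷ pos) , refl ,
  subst (λ u → AbacusOf (∣ U - sucℤ c ∣ ∷ ps) (sucℤ c) ≐ (AbacusOf ps c ∪ ｛ u ｝)) top (abacus-∷ _ ps c)
  where
  c≤U = <⇒≤ c<U
  gap>0 : 0 ℕ.< ∣ U - sucℤ c ∣
  gap>0 = drop‿+<+ (subst (+ 0 <_) (sym (+∣gap∣ c c≤U))
    (suc[i]≤j⇒i<j (≤-by-gap₁ 0 (eq U c) (i<j⇒suc[i]≤j c<U))))
    where eq : ∀ U c → U - (+ 1 + c) - (+ 1 + + 0) ≡ U - (+ 1 + (+ 1 + c)) + + 0
          eq = solve-∀
  top : + ∣ U - sucℤ c ∣ + sucℤ c ≡ U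
  top = trans (cong (_+ sucℤ c) (+∣gap∣ c c≤U)) (eq U c)
    where eq : ∀ U c → U - (+ 1 + c) + (+ 1 + c) ≡ U
          eq = solve-∀

addTopBead : ∀ μ U → Abacus μ ⊆ (_< U) →
             ∃[ ν ] charge ν ≡ sucℤ (charge μ) × Abacus ν ≐ (Abacus μ ∪ ｛ U ｝)
addTopBead (mkCP c [] [] []) U below with U ≟ sucℤ c
... | yes refl = emptyCP (sucℤ c) , refl , ≐-trans (abacus-[] (sucℤ c)) (≤suc≐≤∪suc c)
... | no U≢ = prependBead c U [] c<U [-] []
  where c<U = ≤∧≢⇒< (i<j⇒suc[i]≤j (below (proj₂ (abacus-[] c) ≤-refl))) (U≢ ∘ sym)
addTopBead (mkCP c (p ∷ ps) lk (p>0 ∷ pos)) U below =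
  prependBead c U (p ∷ ps) c<U (drop‿+≤+ (subst (+ p ≤_) (sym (+∣gap∣ c (<⇒≤ c<U))) p≤gap) ∷ lk) (p>0 ∷ pos)
  where
  p+c<U : + p + c < U
  p+c<U = below (topBead (p ∷ ps) c)
  c<U : sucℤ c < U
  c<U = ≤-<-trans (≤-by-gap₁ 0 (eq (+ p) c) (+≤+ p>0)) p+c<U
    where eq : ∀ p c → p + c - (+ 1 + c) ≡ p - (+ 1 + + 0) + + 0
          eq = solve-∀
  p≤gap : + p ≤ U - sucℤ c
  p≤gap = ≤-by-gap₁ 0 (eq (+ p) c U) (i<j⇒suc[i]≤j p+c<U)
    where eq : ∀ p c U → U - (+ 1 + c) - p ≡ U - (+ 1 + (p + c)) + + 0
          eq = solve-∀

indicator : ∀ {A : Set} → Dec A → ℤ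
indicator (yes _) = + 1
indicator (no _)  = + 0

indicator-cong : ∀ {A B : Set} → (A → B) → (B → A) → (a? : Dec A) (b? : Dec B) → indicator a? ≡ indicator b?
indicator-cong _ _ (yes _) (yes _)  = refl
indicator-cong _ _ (no _)  (no _)   = refl
indicator-cong f _ (yes a) (no ¬b)  = ⊥-elim (¬b (f a))
indicator-cong _ g (no ¬a) (yes b)  = ⊥-elim (¬a (g b))

indicator-yes : ∀ {A : Set} → A → (a? : Dec A) → indicator a? ≡ + 1
indicator-yes _ (yes _) = refl
indicator-yes a (no ¬a) = ⊥-elim (¬a a)

indicator-no : ∀ {A : Set} → ¬ A → (a? : Dec A) → indicator a? ≡ + 0
indicator-no ¬a (yes a) = ⊥-elim (¬a a)
indicator-no _  (no _)  = refl

indicator-≤suc : ∀ p c → indicator (p ≤? sucℤ c) ≡ indicator (p ≤? c) + indicator (p ≟ sucℤ c)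
indicator-≤suc p c with p ≟ sucℤ c
... | yes refl = trans (indicator-yes ≤-refl (p ≤? p))
                       (sym (cong (_+ + 1) (indicator-no (<⇒≱ (i<suc[i] c)) (p ≤? c))))
... | no p≢ = trans (indicator-cong (λ p≤ → subst (p ≤_) (pred-suc c) (i<j⇒i≤pred[j] (≤∧≢⇒< p≤ p≢)))
                                   (λ p≤c → ≤-trans p≤c (i≤suc[i] c)) (p ≤? sucℤ c) (p ≤? c))
                    (sym (+-identityʳ _))

count : {P : Pred ℤ 0ℓ} → Decidable P → ℤ → ℕ → ℤ
count P? = windowSum (λ x → indicator (P? x))

<top⇒≤ : ∀ a n {x} → x < a + + suc n → x ≤ a + + n
<top⇒≤ a n {x} x< = subst (x ≤_) (eq a (+ n)) (i<j⇒i≤pred[j] x<)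
  where eq : ∀ a n → - + 1 + (a + (+ 1 + n)) ≡ a + n
        eq = solve-∀

abacusOfWindow : ∀ {P : Pred ℤ 0ℓ} (P? : Decidable P) a n c →
                 (_≤ a) ⊆ P → P ⊆ (_≤ a + + n) → count P? a n ≡ c - a →
                 ∃[ μ ] charge μ ≡ c × Abacus μ ≐ P
abacusOfWindow {P} P? a zero c low high cnt =
  emptyCP c , refl , ≐-trans (abacus-[] c) ((λ {x} x≤c → low (subst (x ≤_) c≡a x≤c))
                                          , λ {x} Px → subst (x ≤_) (trans (+-identityʳ a) (sym c≡a)) (high Px))
  where c≡a = i-j≡0⇒i≡j c a (sym cnt)
abacusOfWindow {P} P? a (suc n) c low high cnt
  with P? (a + + suc n) | windowSum-snoc (λ x → indicator (P? x)) a n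
... | no ¬PU | snoc = abacusOfWindow P? a n c low high′ (trans (sym (+-identityʳ _)) (trans (sym snoc) cnt))
  where
  high′ : P ⊆ (_≤ a + + n)
  high′ {x} Px = <top⇒≤ a n (≤∧≢⇒< (high Px) λ { refl → ¬PU Px })
... | yes PU | snoc = addTopBeadOn (abacusOfWindow P′? a n (pred c) low′ high′ cnt′)
  where
  U = a + + suc n
  P′ : Pred ℤ 0ℓ
  P′ x = P x × x < U
  P′? : Decidable P′
  P′? x = P? x ×-dec (x <? U)
  a<U : a < U
  a<U = suc[i]≤j⇒i<j (suc≤+suc a n)
  low′ : (_≤ a) ⊆ P′
  low′ x≤a = low x≤a , ≤-<-trans x≤a a<U
  high′ : P′ ⊆ (_≤ a + + n)
  high′ P′x = <top⇒≤ a n (proj₂ P′x)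
  cnt′ : count P′? a n ≡ pred c - a
  cnt′ = trans same-count (trans (eq (count P? a n)) (trans (cong (_- + 1) (trans (sym snoc) cnt)) (eq′ c a)))
    where
    same-count : count P′? a n ≡ count P? a n
    same-count = windowSum-cong a n λ _ x≤ →
      indicator-cong proj₁ (λ Px → Px , ≤-<-trans x≤ (+-monoʳ-< a (+<+ (ℕP.n<1+n n))))
                     (P′? _) (P? _)
    eq : ∀ X → X ≡ X + + 1 - + 1
    eq = solve-∀
    eq′ : ∀ c a → c - a - + 1 ≡ - + 1 + c - a
    eq′ = solve-∀
  addTopBeadOn : (∃[ μ ] charge μ ≡ pred c × Abacus μ ≐ P′) → ∃[ ν ] charge ν ≡ c × Abacus ν ≐ P
  addTopBeadOn (μ′ , chμ′ , Aμ′) with addTopBead μ′ U (λ x∈ → proj₂ (proj₁ Aμ′ x∈))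
  ... | ν , chν , Aν = ν , trans chν (trans (cong sucℤ chμ′) (suc-pred c)) , ≐-trans Aν (⊆P , P⊆)
    where
    ⊆P : (Abacus μ′ ∪ ｛ U ｝) ⊆ P
    ⊆P (inj₁ x∈) = proj₁ (proj₁ Aμ′ x∈)
    ⊆P (inj₂ refl) = PU
    P⊆ : P ⊆ (Abacus μ′ ∪ ｛ U ｝)
    P⊆ {x} Px with x ≟ U
    ... | yes refl = inj₂ refl
    ... | no x≢U = inj₁ (proj₂ Aμ′ (Px , ≤∧≢⇒< (high Px) x≢U))

periodic-multiple : ∀ {E} (δ : ℤ → ℤ) → (∀ x → δ (x + E) ≡ δ x) → ∀ q x → δ (x + q * E) ≡ δ x
periodic-multiple {E} δ per (+ n)     x = natural n x
  where
  natural : ∀ n x → δ (x + + n * E) ≡ δ x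
  natural zero    x = cong δ (eq x E)
    where eq : ∀ x E → x + + 0 * E ≡ x
          eq = solve-∀
  natural (suc n) x = trans (cong δ (eq x (+ n) E)) (trans (per _) (natural n x))
    where eq : ∀ x n E → x + (+ 1 + n) * E ≡ x + n * E + E
          eq = solve-∀
periodic-multiple {E} δ per -[1+ n ]  x =
  sym (trans (cong δ (eq x (+ n) E)) (periodic-multiple δ per (+ suc n) (x + -[1+ n ] * E)))
  where eq : ∀ x n E → x ≡ x + - (+ 1 + n) * E + (+ 1 + n) * E
        eq = solve-∀

sumBelow : ℕ → (ℕ → ℕ) → ℕ
sumBelow zero    g = 0
sumBelow (suc n) g = sumBelow n g ℕ.+ g n

≤-sumBelow : ∀ g {r n} → r ℕ.< n → g r ℕ.≤ sumBelow n g
≤-sumBelow g {r} {suc n} r<1+n with r ℕ.≟ n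
... | yes refl = ℕP.m≤n+m (g r) (sumBelow n g)
... | no r≢n   = ℕP.≤-trans (≤-sumBelow g (ℕP.≤∧≢⇒< (ℕP.≤-pred r<1+n) r≢n)) (ℕP.m≤m+n _ (g n))

periodic⇒bounded : ∀ e .{{_ : ℕ.NonZero e}} (δ : ℤ → ℤ) → (∀ x → δ (x + + e) ≡ δ x) →
                   ∃[ B ] ∀ x → ∣ δ x ∣ ℕ.≤ B
periodic⇒bounded e δ per = sumBelow e (λ r → ∣ δ (+ r) ∣) , λ x →
  subst (λ d → ∣ d ∣ ℕ.≤ sumBelow e (λ r → ∣ δ (+ r) ∣)) (sym (δx≡δr x)) (≤-sumBelow (λ r → ∣ δ (+ r) ∣) (n%ℕd<d x e))
  where
  δx≡δr : ∀ x → δ x ≡ δ (+ (x %ℕ e))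
  δx≡δr x = trans (cong δ (a≡a%ℕn+[a/ℕn]*n x e)) (periodic-multiple δ per (x /ℕ e) (+ (x %ℕ e)))

∣∣≤⇒≤ : ∀ {i m} → ∣ i ∣ ℕ.≤ m → i ≤ + m
∣∣≤⇒≤ {+ _}      h = +≤+ h
∣∣≤⇒≤ { -[1+ _ ]} _ = -≤+

module _ {e : ℕ} .{{_ : ℕ.NonZero e}} (w : AffPerm e) where

  preimage : ℤ → ℤ
  preimage x = proj₁ (surjective w x)

  fn∘preimage : ∀ x → fn w (preimage x) ≡ x
  fn∘preimage x = proj₂ (surjective w x) refl

  preimage∘fn : ∀ y → preimage (fn w y) ≡ y
  preimage∘fn y = injective w (fn∘preimage (fn w y))

  preimage-periodic : ∀ x → preimage (x + + e) ≡ preimage x + + e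
  preimage-periodic x = injective w (begin
    fn w (preimage (x + + e))  ≡⟨ fn∘preimage (x + + e) ⟩
    x + + e                    ≡⟨ cong (_+ + e) (fn∘preimage x) ⟨
    fn w (preimage x) + + e    ≡⟨ periodic w (preimage x) ⟨
    fn w (preimage x + + e)    ∎)
    where open ≡-Reasoning

  displacement : ℤ → ℤ
  displacement y = fn w y - y

  displacement-periodic : ∀ y → displacement (y + + e) ≡ displacement y
  displacement-periodic y = trans (cong (_- (y + + e)) (periodic w y)) (eq (fn w y) y (+ e))
    where eq : ∀ x y E → x + E - (y + E) ≡ x - y
          eq = solve-∀

  displacement-sum : windowSum displacement (+ 0) e ≡ + 0
  displacement-sum = *-cancelˡ-≡ (+ 2) _ (+ 0) (begin
    + 2 * windowSum displacement (+ 0) e                                       ≡⟨ cong (+ 2 *_) (windowSum-+ (fn w) (λ x → - x) (+ 0) e) ⟩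
    + 2 * (windowSum (fn w) (+ 0) e + windowSum (λ x → - x) (+ 0) e)
      ≡⟨ cong₂ (λ s t → + 2 * (s + t)) (sym (sumTo≡windowSum e (fn w))) (windowSum-neg (λ x → x) (+ 0) e) ⟩
    + 2 * (sumTo e (fn w) - windowSum (λ x → x) (+ 0) e)                       ≡⟨ eq (sumTo e (fn w)) (windowSum (λ x → x) (+ 0) e) ⟩
    + 2 * sumTo e (fn w) - + 2 * windowSum (λ x → x) (+ 0) e                   ≡⟨ cong₂ _-_ (sumCond w) (gauss e) ⟩
    + e * + suc e - + e * + suc e                                              ≡⟨ i≡j⇒i-j≡0 {+ e * + suc e} refl ⟩
    + 0                                                                        ∎)
    where
    open ≡-Reasoning
    eq : ∀ s t → + 2 * (s - t) ≡ + 2 * s - + 2 * t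
    eq = solve-∀

  Image≤ : ℤ → Pred ℤ 0ℓ
  Image≤ c x = preimage x ≤ c

  image≤? : ∀ c → Decidable (Image≤ c)
  image≤? c x = preimage x ≤? c

  Aset≐Image≤ : ∀ c → Aset w c ≐ Image≤ (+ c)
  Aset≐Image≤ zero    = (λ { (y , y≤0 , refl) → subst (_≤ + 0) (sym (preimage∘fn y)) y≤0 })
                      , λ {x} le → preimage x , le , fn∘preimage x
  Aset≐Image≤ (suc c) = (λ { (inj₁ x∈) → ≤-trans (proj₁ (Aset≐Image≤ c) x∈) (i≤suc[i] (+ c))
                           ; (inj₂ refl) → ≤-reflexive (preimage∘fn (+ suc c)) })
                      , split
    where
    split : Image≤ (+ suc c) ⊆ Aset w (suc c)
    split {x} le with preimage x ≟ + suc c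
    ... | yes p≡ = inj₂ (trans (sym (fn∘preimage x)) (cong (fn w) p≡))
    ... | no p≢ = inj₁ (proj₂ (Aset≐Image≤ c) (subst (preimage x ≤_) (pred-suc (+ c)) (i<j⇒i≤pred[j] (≤∧≢⇒< le p≢))))

  image≤-action : ∀ {c} μ → Abacus μ ≐ Image≤ c → IsAction w (emptyCP c) μ
  image≤-action {c} μ A x =
      (λ x∈ → preimage x , proj₂ (abacus-[] c) (proj₁ A x∈) , fn∘preimage x)
    , λ { (y , y∈ , refl) → proj₂ A (subst (_≤ c) (sym (preimage∘fn y)) (proj₁ (abacus-[] c) y∈)) }

  image≤-core : ∀ {c} μ → Abacus μ ≐ Image≤ c → IsCore e μ
  image≤-core {c} μ A x x∈ = proj₂ A (subst (_≤ c) (sym shifted) (≤-by-gap₁ e (eq (preimage x) c (+ e)) (proj₁ A x∈)))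
    where
    shifted : preimage (x - + e) ≡ preimage x - + e
    shifted = begin
      preimage (x - + e)               ≡⟨ eq′ (preimage (x - + e)) (+ e) ⟩
      preimage (x - + e) + + e - + e   ≡⟨ cong (_- + e) (preimage-periodic (x - + e)) ⟨
      preimage (x - + e + + e) - + e   ≡⟨ cong (λ t → preimage t - + e) (eq″ x (+ e)) ⟩
      preimage x - + e                 ∎
      where
      open ≡-Reasoning
      eq′ : ∀ p E → p ≡ p + E - E
      eq′ = solve-∀
      eq″ : ∀ x E → x - E + E ≡ x
      eq″ = solve-∀
    eq : ∀ p c E → c - (p - E) ≡ c - p + E
    eq = solve-∀

  fn-suc∉Aset : ∀ c → ¬ Aset w c (fn w (+ suc c))
  fn-suc∉Aset c x∈ = <⇒≱ (i<suc[i] (+ c)) (subst (_≤ + c) (preimage∘fn (+ suc c)) (proj₁ (Aset≐Image≤ c) x∈))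

  module BoundedDisplacement (B : ℕ) (∣displacement∣≤B : ∀ y → ∣ displacement y ∣ ℕ.≤ B) where

    M : ℕ
    M = suc B

    fn<+M : ∀ y → fn w y < y + + M
    fn<+M y = suc[i]≤j⇒i<j (≤-by-gap₁ {p = displacement y} {q = + B} 0
      (eq (fn w y) y (+ B)) (∣∣≤⇒≤ (∣displacement∣≤B y)))
      where eq : ∀ x y B → y + (+ 1 + B) - (+ 1 + x) ≡ B - (x - y) + + 0
            eq = solve-∀

    <fn+M : ∀ y → y < fn w y + + M
    <fn+M y = suc[i]≤j⇒i<j (≤-by-gap₁ {p = - displacement y} {q = + B} 0
      (eq (fn w y) y (+ B))
      (∣∣≤⇒≤ (subst (ℕ._≤ B) (sym (∣-i∣≡∣i∣ (displacement y))) (∣displacement∣≤B y))))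
      where eq : ∀ x y B → x + (+ 1 + B) - (+ 1 + y) ≡ B - (- (x - y)) + + 0
            eq = solve-∀

    preimage<+M : ∀ x → preimage x < x + + M
    preimage<+M x = subst (λ t → preimage x < t + + M) (fn∘preimage x) (<fn+M (preimage x))

    <preimage+M : ∀ x → x < preimage x + + M
    <preimage+M x = subst (_< preimage x + + M) (fn∘preimage x) (fn<+M (preimage x))

    image≤-low : ∀ c {x} → x ≤ c - + M → Image≤ c x
    image≤-low c {x} x≤ = <⇒≤ (<-≤-trans (preimage<+M x) (≤-by-gap₁ 0 (eq c x (+ M)) x≤))
      where eq : ∀ c x M → c - (x + M) ≡ c - M - x + + 0
            eq = solve-∀

    image≤-high : ∀ c {x} → Image≤ c x → x < c + + M
    image≤-high c {x} le = <-≤-trans (<preimage+M x) (+-monoˡ-≤ (+ M) le)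

    N : ℕ
    N = M ℕ.+ M

    window-top : ∀ c → c - + M + + N ≡ c + + M
    window-top c = trans (cong (λ t → c - + M + t) (pos-+ M M)) (eq c (+ M))
      where eq : ∀ c M → c - M + (M + M) ≡ c + M
            eq = solve-∀

    window-top+1 : ∀ c → c - + M + + suc N ≡ sucℤ (c + + M)
    window-top+1 c = trans (sym (suc-+-swap (c - + M) N)) (trans (+-assoc (+ 1) (c - + M) (+ N)) (cong sucℤ (window-top c)))

    imageSum : ℤ → (ℤ → ℤ) → ℤ
    imageSum c g = windowSum (λ x → indicator (image≤? c x) * g x) (c - + M) N

    imageSum-slide : ∀ c g → imageSum (sucℤ c) g + g (sucℤ c - + M) ≡ imageSum c g + g (fn w (sucℤ c))
    imageSum-slide c g = begin
      imageSum (sucℤ c) g + g b                                    ≡⟨ +-comm _ (g b) ⟩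
      g b + imageSum (sucℤ c) g                                    ≡⟨ cong (_+ imageSum (sucℤ c) g) bottom ⟨
      G₁ b * g b + imageSum (sucℤ c) g                             ≡⟨ cong₂ (λ u v → G₁ u * g u + windowSum (λ x → G₁ x * g x) v N) a+1≡b a+1≡b ⟨
      windowSum (λ x → G₁ x * g x) a (suc N)                       ≡⟨ windowSum-cong a (suc N) (λ {x} _ _ → split x) ⟩
      windowSum (λ x → G₀ x * g x + H x * g x) a (suc N)           ≡⟨ windowSum-+ (λ x → G₀ x * g x) (λ x → H x * g x) a (suc N) ⟩
      windowSum (λ x → G₀ x * g x) a (suc N) + windowSum (λ x → H x * g x) a (suc N)
                                                                   ≡⟨ cong₂ _+_ old new ⟩
      imageSum c g + g z                                           ∎
      where
      open ≡-Reasoning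
      a = c - + M
      b = sucℤ c - + M
      z = fn w (sucℤ c)
      G₀ G₁ H : ℤ → ℤ
      G₀ x = indicator (image≤? c x)
      G₁ x = indicator (image≤? (sucℤ c) x)
      H x = indicator (preimage x ≟ sucℤ c)
      a+1≡b : sucℤ a ≡ b
      a+1≡b = sym (+-assoc (+ 1) c (- + M))
      bottom : G₁ b * g b ≡ g b
      bottom = trans (cong (_* g b) (indicator-yes (image≤-low (sucℤ c) ≤-refl) (image≤? (sucℤ c) b))) (*-identityˡ (g b))
      split : ∀ x → G₁ x * g x ≡ G₀ x * g x + H x * g x
      split x = trans (cong (_* g x) (indicator-≤suc (preimage x) c)) (*-distribʳ-+ (g x) (G₀ x) (H x))
      old : windowSum (λ x → G₀ x * g x) a (suc N) ≡ imageSum c g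
      old = trans (windowSum-snoc (λ x → G₀ x * g x) a N) (trans (cong (λ t → imageSum c g + t) top-empty) (+-identityʳ _))
        where
        top-empty : G₀ (a + + suc N) * g (a + + suc N) ≡ + 0
        top-empty = cong (_* g (a + + suc N)) (indicator-no
          (λ le → <⇒≱ (image≤-high c le) (≤-trans (i≤suc[i] (c + + M)) (≤-reflexive (sym (window-top+1 c)))))
          (image≤? c (a + + suc N)))
      new : windowSum (λ x → H x * g x) a (suc N) ≡ g z
      new = trans (windowSum-point a (suc N) z a<z z≤top vanish) at-z
        where
        a<z : a < z
        a<z = suc[i]≤j⇒i<j (≤-by-gap₁ 1 (eq z c (+ M)) (i<j⇒suc[i]≤j (<fn+M (sucℤ c))))
          where eq : ∀ z c M → z - (+ 1 + (c - M)) ≡ z + M - (+ 1 + (+ 1 + c)) + + 1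
                eq = solve-∀
        z≤top : z ≤ a + + suc N
        z≤top = subst (z ≤_) (sym (window-top+1 c)) (≤-by-gap₁ 1 (eq z c (+ M)) (i<j⇒suc[i]≤j (fn<+M (sucℤ c))))
          where eq : ∀ z c M → + 1 + (c + M) - z ≡ + 1 + c + M - (+ 1 + z) + + 1
                eq = solve-∀
        vanish : ∀ {x} → x ≢ z → H x * g x ≡ + 0
        vanish {x} x≢z = cong (_* g x) (indicator-no (λ eq → x≢z (trans (sym (fn∘preimage x)) (cong (fn w) eq))) (preimage x ≟ sucℤ c))
        at-z : H z * g z ≡ g z
        at-z = trans (cong (_* g z) (indicator-yes (preimage∘fn (sucℤ c)) (preimage z ≟ sucℤ c))) (*-identityˡ (g z))

    imageSum-cong : ∀ c {g h} → (∀ x → g x ≡ h x) → imageSum c g ≡ imageSum c h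
    imageSum-cong c g≡h = windowSum-cong (c - + M) N λ {x} _ _ → cong (indicator (image≤? c x) *_) (g≡h x)

    imageSum-- : ∀ c g h → imageSum c (λ x → g x - h x) ≡ imageSum c g - imageSum c h
    imageSum-- c g h = begin
      windowSum (λ x → G x * (g x - h x)) a N                ≡⟨ windowSum-cong a N (λ {x} _ _ → distrib (G x) (g x) (h x)) ⟩
      windowSum (λ x → G x * g x + - (G x * h x)) a N        ≡⟨ windowSum-+ (λ x → G x * g x) (λ x → - (G x * h x)) a N ⟩
      imageSum c g + windowSum (λ x → - (G x * h x)) a N     ≡⟨ cong (λ t → imageSum c g + t) (windowSum-neg (λ x → G x * h x) a N) ⟩
      imageSum c g - imageSum c h                            ∎
      where
      open ≡-Reasoning
      a = c - + M
      G : ℤ → ℤ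
      G x = indicator (image≤? c x)
      distrib : ∀ u v t → u * (v - t) ≡ u * v + - (u * t)
      distrib = solve-∀

    beadCount : ℤ → ℤ
    beadCount c = imageSum c (λ _ → + 1)

    beadCount-suc : ∀ c → beadCount (sucℤ c) ≡ beadCount c
    beadCount-suc c = +-cancelʳ (+ 1) (imageSum-slide c (λ _ → + 1))

    beadCount-constant : ∀ c → beadCount c ≡ beadCount (+ 0)
    beadCount-constant (+ zero)        = refl
    beadCount-constant (+ suc n)       = trans (beadCount-suc (+ n)) (beadCount-constant (+ n))
    beadCount-constant -[1+ zero ]     = sym (beadCount-suc -[1+ zero ])
    beadCount-constant -[1+ suc n ]    = trans (sym (beadCount-suc -[1+ suc n ])) (beadCount-constant -[1+ n ])

    moment : ℤ → ℤ
    moment c = imageSum c (λ x → x - (c - + M))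

    moment-suc : ∀ c → moment (sucℤ c) - moment c ≡ + M - beadCount c + displacement (sucℤ c)
    moment-suc c = begin
      moment (sucℤ c) - moment c                         ≡⟨ cong (_- moment c) slid ⟩
      imageSum c g + g z - g b - moment c                ≡⟨ cong (λ t → t + g z - g b - moment c) shifted ⟩
      moment c - beadCount c + g z - g b - moment c      ≡⟨ eq (moment c) (beadCount c) z c (+ M) ⟩
      + M - beadCount c + displacement (sucℤ c)          ∎
      where
      open ≡-Reasoning
      b = sucℤ c - + M
      z = fn w (sucℤ c)
      g : ℤ → ℤ
      g x = x - b
      slid : moment (sucℤ c) ≡ imageSum c g + g z - g b
      slid = trans (eq′ (moment (sucℤ c)) (g b)) (cong (_- g b) (imageSum-slide c g))
        where eq′ : ∀ u v → u ≡ u + v - v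
              eq′ = solve-∀
      shifted : imageSum c g ≡ moment c - beadCount c
      shifted = trans (imageSum-cong c (λ x → eq″ x c (+ M))) (imageSum-- c (λ x → x - (c - + M)) (λ _ → + 1))
        where eq″ : ∀ x c M → x - (+ 1 + c - M) ≡ x - (c - M) - + 1
              eq″ = solve-∀
      eq : ∀ m k z c M → m - k + (z - (+ 1 + c - M)) - ((+ 1 + c - M) - (+ 1 + c - M)) - m ≡ M - k + (z - (+ 1 + c))
      eq = solve-∀

    moment-periodic : ∀ c → moment (c + + e) ≡ moment c
    moment-periodic c = begin
      windowSum h (c + E - + M) N                                           ≡⟨ cong (λ a → windowSum h a N) (eq c E (+ M)) ⟩
      windowSum h (c - + M + E) N                                           ≡⟨ windowSum-shift h (c - + M) E N ⟩
      windowSum (λ x → G′ (x + E) * (x + E - (c + E - + M))) (c - + M) N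
        ≡⟨ windowSum-cong (c - + M) N (λ {x} _ _ → cong₂ _*_ (same-bead x) (eq′ x c E (+ M))) ⟩
      moment c                                                              ∎
      where
      open ≡-Reasoning
      E = + e
      G′ : ℤ → ℤ
      G′ x = indicator (image≤? (c + E) x)
      h : ℤ → ℤ
      h x = G′ x * (x - (c + E - + M))
      same-bead : ∀ x → G′ (x + E) ≡ indicator (image≤? c x)
      same-bead x = indicator-cong
        (λ le → ≤-by-gap₁ 0 (eq″ (preimage x) c E) (subst (_≤ c + E) (preimage-periodic x) le))
        (λ le → subst (_≤ c + E) (sym (preimage-periodic x)) (+-monoˡ-≤ E le))
        (image≤? (c + E) (x + E)) (image≤? c x)
        where eq″ : ∀ p c E → c - p ≡ c + E - (p + E) + + 0
              eq″ = solve-∀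
      eq : ∀ c E M → c + E - M ≡ c - M + E
      eq = solve-∀
      eq′ : ∀ x c E M → x + E - (c + E - M) ≡ x - (c - M)
      eq′ = solve-∀

    -- Telescoping the moment over one period gives e · (M − beadCount) + Σ displacement = 0.
    beadCount≡M : ∀ c → beadCount c ≡ + M
    beadCount≡M c = trans (beadCount-constant c)
      (sym (i-j≡0⇒i≡j (+ M) (beadCount (+ 0)) (*-cancelˡ-≡ (+ e) _ (+ 0) telescoped)))
      where
      open ≡-Reasoning
      K = + M - beadCount (+ 0)
      step : ∀ x → moment x - moment (pred x) ≡ K + displacement x
      step x = begin
        moment x - moment (pred x)                                        ≡⟨ cong (λ t → moment t - moment (pred x)) (suc-pred x) ⟨
        moment (sucℤ (pred x)) - moment (pred x)                          ≡⟨ moment-suc (pred x) ⟩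
        + M - beadCount (pred x) + displacement (sucℤ (pred x))
          ≡⟨ cong₂ (λ k d → + M - k + displacement d) (beadCount-constant (pred x)) (suc-pred x) ⟩
        K + displacement x                                                ∎
      telescoped : + e * K ≡ + e * + 0
      telescoped = begin
        + e * K                                                           ≡⟨ +-identityʳ _ ⟨
        + e * K + + 0                                                     ≡⟨ cong₂ _+_ (windowSum-const K (+ 0) e) displacement-sum ⟨
        windowSum (λ _ → K) (+ 0) e + windowSum displacement (+ 0) e      ≡⟨ windowSum-+ (λ _ → K) displacement (+ 0) e ⟨
        windowSum (λ x → K + displacement x) (+ 0) e                      ≡⟨ windowSum-cong (+ 0) e (λ {x} _ _ → step x) ⟨
        windowSum (λ x → moment x - moment (pred x)) (+ 0) e              ≡⟨ windowSum-telescope moment (+ 0) e ⟩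
        moment (+ e) - moment (+ 0)                                       ≡⟨ i≡j⇒i-j≡0 (moment-periodic (+ 0)) ⟩
        + 0                                                               ≡⟨ *-zeroʳ (+ e) ⟨
        + e * + 0                                                         ∎

    imageAbacus : ∀ c → ∃[ μ ] charge μ ≡ c × Abacus μ ≐ Image≤ c
    imageAbacus c = abacusOfWindow (image≤? c) (c - + M) N c (image≤-low c) high counted
      where
      high : Image≤ c ⊆ (_≤ c - + M + + N)
      high {x} le = subst (x ≤_) (sym (window-top c)) (<⇒≤ (image≤-high c le))
      counted : count (image≤? c) (c - + M) N ≡ c - (c - + M)
      counted = begin
        count (image≤? c) (c - + M) N   ≡⟨ windowSum-cong (c - + M) N (λ {x} _ _ → sym (*-identityʳ (indicator (image≤? c x)))) ⟩
        beadCount c                     ≡⟨ beadCount≡M c ⟩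
        + M                             ≡⟨ eq c (+ M) ⟩
        c - (c - + M)                   ∎
        where
        open ≡-Reasoning
        eq : ∀ c M → M ≡ c - (c - M)
        eq = solve-∀

  Aset-abacus : ∀ c → ∃[ μ ] charge μ ≡ + c × IsAction w (emptyCP (+ c)) μ × IsCore e μ × Aset w c ≐ Abacus μ
  Aset-abacus c = μ , charge≡c , image≤-action μ A , image≤-core μ A , ≐-trans (Aset≐Image≤ c) (≐-sym A)
    where
    bounded = periodic⇒bounded e displacement displacement-periodic
    open BoundedDisplacement (proj₁ bounded) (proj₂ bounded)
    μ = proj₁ (imageAbacus (+ c))
    charge≡c = proj₁ (proj₂ (imageAbacus (+ c)))
    A = proj₂ (proj₂ (imageAbacus (+ c)))

proposition4p8 : (e : ℕ) → 2 ℕ.≤ e → (w : AffPerm e) →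
    ((c : ℕ) → suc c ℕ.< e → ¬ Aset w c (fn w (+ suc c)))
    × ((c : ℕ) → c ℕ.< e →
        ∃[ μ ] (charge μ ≡ + c
               × IsAction w (emptyCP (+ c)) μ
               × IsCore e μ
               × (∀ x → (Aset w c x → Abacus μ x) × (Abacus μ x → Aset w c x))))
proposition4p8 (suc e) _ w = (λ c _ → fn-suc∉Aset w c) , λ c _ → witness c
  where
  witness : ∀ c → ∃[ μ ] (charge μ ≡ + c × IsAction w (emptyCP (+ c)) μ × IsCore (suc e) μ
                          × (∀ x → (Aset w c x → Abacus μ x) × (Abacus μ x → Aset w c x)))
  witness c = let μ , charge≡c , action , core , A = Aset-abacus w c in
              μ , charge≡c , action , core , λ x → proj₁ A , proj₂ A
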